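{- Let $R$ be a proposition rewrite system and $A$ a closed proposition containing no predicate or function symbol appearing in $R$; let $R^A$ be the $A$-translation of $R$. For all propositions $B,C$: if $B\to_R C$ then $B^A\to_{R^A} C^A$; and if $B\equiv_R C$ then $B^A\equiv_{R^A} C^A$.
   Context: Propositions are first-order with connectives $\wedge,\vee,\Rightarrow,\top,\bot$ and quantifiers $\forall,\exists$. A proposition rewrite system is an orthogonal set of rules $P\to F$ with $P$ atomic and $FV(F)\subseteq FV(P)$; $\to_R$ is the one-step rewrite relation (rewriting an instance of some $P$ occurring as an atomic subformula) and $\equiv_R$ the congruence generated. Writing $\neg_A X:=(X\Rightarrow A)\Rightarrow A$, the $A$-translation is: $B^A=B$ for atomic $B$; $\top^A=\top$; $\bot^A=\bot$; $(B\circ C)^A=\neg_A B^A\circ\neg_A C^A$ for $\circ\in\{\Rightarrow,\wedge,\vee\}$; $(Qx B)^A=Qx\,\neg_A B^A$ for $Q\in\{\forall,\exists\}$. For $R=\{P_i\to F_i\}$, $R^A=\{P_i\to F_i^A\}$. -}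

module Defs where

open import Data.Nat using (ℕ; zero; suc)
open import Data.List using (List; []; _∷_; _++_)
open import Data.List.Membership.Propositional using (_∈_)
open import Data.List.Relation.Unary.Unique.Propositional using (Unique)
open import Data.Product using (_×_; Σ)
open import Data.Sum using (_⊎_)
open import Relation.Nullary using (¬_)
open import Relation.Binary.PropositionalEquality using (_≡_)
open import Relation.Binary.Construct.Closure.Equivalence using (EqClosure)

-- Syntax (locally nameless / de Bruijn indices for variables).
-- Function and predicate symbols are named by natural numbers.

data Term : Set where
  var : ℕ → Term
  fun : ℕ → List Term → Term

infixr 5 _⊃_
infixr 6 _∧_ _∨_

data Form : Set where
  atom : ℕ → List Term → Form
  top  : Form
  bot  : Form
  _⊃_  : Form → Form → Form
  _∧_  : Form → Form → Form
  _∨_  : Form → Form → Form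
  all  : Form → Form      -- ∀x B, x is de Bruijn index 0 in B
  ex   : Form → Form

Subst : Set
Subst = ℕ → Term

mutual
  substT : Subst → Term → Term
  substT σ (var n)    = σ n
  substT σ (fun f ts) = fun f (substTs σ ts)

  substTs : Subst → List Term → List Term
  substTs σ []       = []
  substTs σ (t ∷ ts) = substT σ t ∷ substTs σ ts

shiftT : Term → Term
shiftT = substT (λ m → var (suc m))

lift : Subst → Subst
lift σ zero    = var zero
lift σ (suc n) = shiftT (σ n)

substF : Subst → Form → Form
substF σ (atom p ts) = atom p (substTs σ ts)
substF σ top         = top
substF σ bot         = bot
substF σ (B ⊃ C)     = substF σ B ⊃ substF σ C
substF σ (B ∧ C)     = substF σ B ∧ substF σ C
substF σ (B ∨ C)     = substF σ B ∨ substF σ C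
substF σ (all B)     = all (substF (lift σ) B)
substF σ (ex B)      = ex (substF (lift σ) B)

mutual
  varsT : Term → List ℕ
  varsT (var n)    = n ∷ []
  varsT (fun f ts) = varsTs ts

  varsTs : List Term → List ℕ
  varsTs []       = []
  varsTs (t ∷ ts) = varsT t ++ varsTs ts

data FreeIn : ℕ → Form → Set where
  atom  : ∀ {n p ts} → n ∈ varsTs ts → FreeIn n (atom p ts)
  ⊃ˡ    : ∀ {n B C} → FreeIn n B → FreeIn n (B ⊃ C)
  ⊃ʳ    : ∀ {n B C} → FreeIn n C → FreeIn n (B ⊃ C)
  ∧ˡ    : ∀ {n B C} → FreeIn n B → FreeIn n (B ∧ C)
  ∧ʳ    : ∀ {n B C} → FreeIn n C → FreeIn n (B ∧ C)
  ∨ˡ    : ∀ {n B C} → FreeIn n B → FreeIn n (B ∨ C)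
  ∨ʳ    : ∀ {n B C} → FreeIn n C → FreeIn n (B ∨ C)
  all   : ∀ {n B} → FreeIn (suc n) B → FreeIn n (all B)
  ex    : ∀ {n B} → FreeIn (suc n) B → FreeIn n (ex B)

Closed : Form → Set
Closed A = ∀ n → ¬ FreeIn n A

mutual
  data FunInT (f : ℕ) : Term → Set where
    here  : ∀ {ts} → FunInT f (fun f ts)
    there : ∀ {g ts} → FunInTs f ts → FunInT f (fun g ts)

  data FunInTs (f : ℕ) : List Term → Set where
    here  : ∀ {t ts} → FunInT f t → FunInTs f (t ∷ ts)
    there : ∀ {t ts} → FunInTs f ts → FunInTs f (t ∷ ts)

data FunIn (f : ℕ) : Form → Set where
  atom  : ∀ {p ts} → FunInTs f ts → FunIn f (atom p ts)
  ⊃ˡ    : ∀ {B C} → FunIn f B → FunIn f (B ⊃ C)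
  ⊃ʳ    : ∀ {B C} → FunIn f C → FunIn f (B ⊃ C)
  ∧ˡ    : ∀ {B C} → FunIn f B → FunIn f (B ∧ C)
  ∧ʳ    : ∀ {B C} → FunIn f C → FunIn f (B ∧ C)
  ∨ˡ    : ∀ {B C} → FunIn f B → FunIn f (B ∨ C)
  ∨ʳ    : ∀ {B C} → FunIn f C → FunIn f (B ∨ C)
  all   : ∀ {B} → FunIn f B → FunIn f (all B)
  ex    : ∀ {B} → FunIn f B → FunIn f (ex B)

data PredIn (p : ℕ) : Form → Set where
  atom  : ∀ {ts} → PredIn p (atom p ts)
  ⊃ˡ    : ∀ {B C} → PredIn p B → PredIn p (B ⊃ C)
  ⊃ʳ    : ∀ {B C} → PredIn p C → PredIn p (B ⊃ C)
  ∧ˡ    : ∀ {B C} → PredIn p B → PredIn p (B ∧ C)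
  ∧ʳ    : ∀ {B C} → PredIn p C → PredIn p (B ∧ C)
  ∨ˡ    : ∀ {B C} → PredIn p B → PredIn p (B ∨ C)
  ∨ʳ    : ∀ {B C} → PredIn p C → PredIn p (B ∨ C)
  all   : ∀ {B} → PredIn p B → PredIn p (all B)
  ex    : ∀ {B} → PredIn p B → PredIn p (ex B)

record Rule : Set where
  field
    pred : ℕ
    args : List Term
    rhs  : Form

open Rule public

lhs : Rule → Form
lhs r = atom (pred r) (args r)

record IsPropRewriteSystem {I : Set} (R : I → Rule) : Set where
  field
    fv-rhs⊆lhs : ∀ i n → FreeIn n (rhs (R i)) → n ∈ varsTs (args (R i))
    left-linear : ∀ i → Unique (varsTs (args (R i)))
    non-overlapping : ∀ i j (σ τ : Subst) →
      substF σ (lhs (R i)) ≡ substF τ (lhs (R j)) → R i ≡ R j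

data Step {I : Set} (R : I → Rule) : Form → Form → Set where
  root : ∀ i (σ : Subst) → Step R (substF σ (lhs (R i))) (substF σ (rhs (R i)))
  ⊃ˡ   : ∀ {B B′ C} → Step R B B′ → Step R (B ⊃ C) (B′ ⊃ C)
  ⊃ʳ   : ∀ {B C C′} → Step R C C′ → Step R (B ⊃ C) (B ⊃ C′)
  ∧ˡ   : ∀ {B B′ C} → Step R B B′ → Step R (B ∧ C) (B′ ∧ C)
  ∧ʳ   : ∀ {B C C′} → Step R C C′ → Step R (B ∧ C) (B ∧ C′)
  ∨ˡ   : ∀ {B B′ C} → Step R B B′ → Step R (B ∨ C) (B′ ∨ C)
  ∨ʳ   : ∀ {B C C′} → Step R C C′ → Step R (B ∨ C) (B ∨ C′)
  all  : ∀ {B B′} → Step R B B′ → Step R (all B) (all B′)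
  ex   : ∀ {B B′} → Step R B B′ → Step R (ex B) (ex B′)

-- ≡_R : the congruence generated (= equivalence closure of →_R,
-- which is already closed under contexts)
Conv : {I : Set} (R : I → Rule) → Form → Form → Set
Conv R = EqClosure (Step R)

¬[_]_ : Form → Form → Form
¬[ A ] X = (X ⊃ A) ⊃ A

_^[_] : Form → Form → Form
atom p ts ^[ A ] = atom p ts
top ^[ A ]       = top
bot ^[ A ]       = bot
(B ⊃ C) ^[ A ]   = (¬[ A ] (B ^[ A ])) ⊃ (¬[ A ] (C ^[ A ]))
(B ∧ C) ^[ A ]   = (¬[ A ] (B ^[ A ])) ∧ (¬[ A ] (C ^[ A ]))
(B ∨ C) ^[ A ]   = (¬[ A ] (B ^[ A ])) ∨ (¬[ A ] (C ^[ A ]))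
all B ^[ A ]     = all (¬[ A ] (B ^[ A ]))
ex B ^[ A ]      = ex (¬[ A ] (B ^[ A ]))

translateRS : {I : Set} → Form → (I → Rule) → (I → Rule)
translateRS A R i = record { pred = pred (R i) ; args = args (R i) ; rhs = rhs (R i) ^[ A ] }

PredInRule : ℕ → Rule → Set
PredInRule p r = PredIn p (lhs r) ⊎ PredIn p (rhs r)

FunInRule : ℕ → Rule → Set
FunInRule f r = FunIn f (lhs r) ⊎ FunIn f (rhs r)

FreshFor : {I : Set} → Form → (I → Rule) → Set
FreshFor A R =
  (∀ i p → PredInRule p (R i) → ¬ PredIn p A) ×
  (∀ i f → FunInRule f (R i) → ¬ FunIn f A)

-- The A-translation leaves atoms alone and commutes with substitution, because the
-- only formula it inserts is A, which is closed and hence fixed by every substitution. So an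
-- instance σP → σF of a rule translates to σP → σ(F^A), an instance of the rule P → F^A
-- of R^A; a redex under a connective or quantifier becomes a redex under the added
-- double negations.
module Submission where

open import Data.Nat using (ℕ; zero; suc)
open import Data.List using (List; []; _∷_)
open import Data.List.Membership.Propositional using (_∈_)
open import Data.List.Membership.Propositional.Properties using (∈-++⁺ˡ; ∈-++⁺ʳ)
open import Data.List.Relation.Unary.Any using (here)
open import Data.Product using (_×_; _,_)
open import Data.Empty using (⊥-elim)
open import Relation.Binary.PropositionalEquality using (_≡_; refl; sym; cong; cong₂)
open import Relation.Binary.Construct.Closure.Equivalence using (gmap)

open import Defs

mutual
  substT-id : ∀ σ t → (∀ {n} → n ∈ varsT t → σ n ≡ var n) → substT σ t ≡ t
  substT-id σ (var n)    fixes = fixes (here refl)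
  substT-id σ (fun f ts) fixes = cong (fun f) (substTs-id σ ts fixes)

  substTs-id : ∀ σ ts → (∀ {n} → n ∈ varsTs ts → σ n ≡ var n) → substTs σ ts ≡ ts
  substTs-id σ []       fixes = refl
  substTs-id σ (t ∷ ts) fixes =
    cong₂ _∷_ (substT-id σ t (λ m → fixes (∈-++⁺ˡ m)))
              (substTs-id σ ts (λ m → fixes (∈-++⁺ʳ (varsT t) m)))

lift-fixes : ∀ σ {P : ℕ → Set} → (∀ {n} → P (suc n) → σ n ≡ var n) →
             ∀ {n} → P n → lift σ n ≡ var n
lift-fixes σ fixes {zero}  _ = refl
lift-fixes σ fixes {suc n} p = cong shiftT (fixes p)

substF-id : ∀ σ B → (∀ {n} → FreeIn n B → σ n ≡ var n) → substF σ B ≡ B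
substF-id σ (atom p ts) fixes = cong (atom p) (substTs-id σ ts (λ m → fixes (atom m)))
substF-id σ top         fixes = refl
substF-id σ bot         fixes = refl
substF-id σ (B ⊃ C)     fixes =
  cong₂ _⊃_ (substF-id σ B (λ x → fixes (⊃ˡ x)))
            (substF-id σ C (λ x → fixes (⊃ʳ x)))
substF-id σ (B ∧ C)     fixes =
  cong₂ _∧_ (substF-id σ B (λ x → fixes (∧ˡ x)))
            (substF-id σ C (λ x → fixes (∧ʳ x)))
substF-id σ (B ∨ C)     fixes =
  cong₂ _∨_ (substF-id σ B (λ x → fixes (∨ˡ x)))
            (substF-id σ C (λ x → fixes (∨ʳ x)))
substF-id σ (all B)     fixes =
  cong all (substF-id (lift σ) B (lift-fixes σ {λ n → FreeIn n B} (λ x → fixes (all x))))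
substF-id σ (ex B)      fixes =
  cong ex (substF-id (lift σ) B (lift-fixes σ {λ n → FreeIn n B} (λ x → fixes (ex x))))

substF-closed : ∀ {A} → Closed A → ∀ σ → substF σ A ≡ A
substF-closed {A} closed σ = substF-id σ A (λ {n} x → ⊥-elim (closed n x))

module _ {A : Form} (closed : Closed A) where

  mutual
    substF-^ : ∀ σ B → substF σ B ^[ A ] ≡ substF σ (B ^[ A ])
    substF-^ σ (atom p ts) = refl
    substF-^ σ top         = refl
    substF-^ σ bot         = refl
    substF-^ σ (B ⊃ C)     = cong₂ _⊃_ (substF-¬^ σ B) (substF-¬^ σ C)
    substF-^ σ (B ∧ C)     = cong₂ _∧_ (substF-¬^ σ B) (substF-¬^ σ C)
    substF-^ σ (B ∨ C)     = cong₂ _∨_ (substF-¬^ σ B) (substF-¬^ σ C)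
    substF-^ σ (all B)     = cong all (substF-¬^ (lift σ) B)
    substF-^ σ (ex B)      = cong ex (substF-¬^ (lift σ) B)

    substF-¬^ : ∀ σ B → ¬[ A ] (substF σ B ^[ A ]) ≡ substF σ (¬[ A ] (B ^[ A ]))
    substF-¬^ σ B =
      cong₂ (λ X A′ → (X ⊃ A′) ⊃ A′) (substF-^ σ B) (sym (substF-closed closed σ))

  Step-^ : ∀ {I} {R : I → Rule} {B C} →
           Step R B C → Step (translateRS A R) (B ^[ A ]) (C ^[ A ])
  Step-^ {R = R} (root i σ) rewrite substF-^ σ (rhs (R i)) = root i σ
  Step-^ (⊃ˡ s)  = ⊃ˡ (⊃ˡ (⊃ˡ (Step-^ s)))
  Step-^ (⊃ʳ s)  = ⊃ʳ (⊃ˡ (⊃ˡ (Step-^ s)))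
  Step-^ (∧ˡ s)  = ∧ˡ (⊃ˡ (⊃ˡ (Step-^ s)))
  Step-^ (∧ʳ s)  = ∧ʳ (⊃ˡ (⊃ˡ (Step-^ s)))
  Step-^ (∨ˡ s)  = ∨ˡ (⊃ˡ (⊃ˡ (Step-^ s)))
  Step-^ (∨ʳ s)  = ∨ʳ (⊃ˡ (⊃ˡ (Step-^ s)))
  Step-^ (all s) = all (⊃ˡ (⊃ˡ (Step-^ s)))
  Step-^ (ex s)  = ex (⊃ˡ (⊃ˡ (Step-^ s)))

  Conv-^ : ∀ {I} {R : I → Rule} {B C} →
           Conv R B C → Conv (translateRS A R) (B ^[ A ]) (C ^[ A ])
  Conv-^ = gmap (_^[ A ]) Step-^

proposition7 : {I : Set} (R : I → Rule) → IsPropRewriteSystem R →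
    (A : Form) → Closed A → FreshFor A R →
    (∀ B C → Step R B C → Step (translateRS A R) (B ^[ A ]) (C ^[ A ])) ×
    (∀ B C → Conv R B C → Conv (translateRS A R) (B ^[ A ]) (C ^[ A ]))
proposition7 R _ A closed _ =
  (λ _ _ → Step-^ closed) , (λ _ _ → Conv-^ closed)
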